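{- Let $n\geq 2k+1$, $x\in X_{n,k}$, and let $\gamma=(A,B)\in\Gamma(x)$ have minimum speed $v(\gamma)=\min V(x)$. Then $\gamma$ is clean, i.e., the subword of $\widehat{x}$ on the interval $[\min A,\max B]$ equals $1^{v(\gamma)}0^{v(\gamma)}$ or $0^{v(\gamma)}1^{v(\gamma)}$.
   Context: Let $k\geq1$, $n\geq 2k+1$, and $X_{n,k}$ be the set of binary strings of length $n$ with exactly $k$ ones, indices taken cyclically. Parenthesis matching: regarding $x$ cyclically, each $1$ is matched to the last $0$ of the shortest cyclic substring starting at this $1$ and going rightwards that contains equally many $0$s and $1$s; every $1$ is matched, and $n-2k$ zeros are unmatched. Let $\widehat{x}$ be the bi-infinite string with $\widehat{x}_i=x_{i \bmod n}$ for $i\in\mathbb{Z}$, with matched/unmatched status inherited, viewed as a lattice path: matched $1$ = up-step, matched $0$ = down-step, unmatched $0$ = flat step, heights normalized so flat steps lie at height $0$. Let $D$ be the set of Dyck words, $\varepsilon$ the empty word, $D'=\{1u0:u\in D\}$, and $\overline{z}$ the bitwise complement of $z$. Every $y\in D'$ of height $h$ decomposes uniquely as $y=10$ if $h=1$, and otherwise as $y=1u_1\,1u_2\cdots 1u_{h-2}\,1\,1\,v_0\,0\,v_1\,0\cdots 0\,v_{h-2}\,0\,0$ with $u_i\in D$, $\overline{v_i}\in D$. For a word $y$ occupying consecutive positions of $\mathbb{Z}$ (positions retained): $\Gamma(\varepsilon)=\emptyset$; if $y\in D\setminus(D'\cup\{\varepsilon\})$, $y=y_1\cdots y_\ell$ with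 $y_i\in D'$, then $\Gamma(y)=\bigcup_i\Gamma(y_i)$; if $y\in D'$, $\Gamma(y)=\bigcup_{i=1}^{h-2}\Gamma(u_i)\cup\bigcup_{i=0}^{h-2}\Gamma(\overline{v_i})\cup\{(A,B)\}$, where $\overline{v_i}$ is the complemented word occupying the same positions as $v_i$, $A$ is the set of positions of the $1$s of $y$ not in any $u_i$ or $v_i$, and $B$ the set of positions of the $0$s of $y$ not in any $u_i$ or $v_i$. $\Gamma(x)=\bigcup\Gamma(y)$ over all subwords $y\in D'$ of $\widehat{x}$ starting and ending at height $0$; its elements are gliders, with speed $v((A,B))=|A|=|B|$. Two gliders are equivalent if one is obtained from the other by shifting all positions by the same integer multiple of $n$; $V(x)$ is the multiset of speeds of one representative of each equivalence class. -}

module Defs where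

open import Data.Bool using (Bool; true; false; not)
open import Data.Nat as ℕ using (ℕ; zero; suc; _⊔_; _∸_; _<_)
open import Data.Integer as ℤ using (ℤ; +_)
open import Data.Integer.DivMod using (_%ℕ_)
open import Data.Nat.DivMod using (_mod_)
open import Data.Vec using (Vec; lookup)
open import Data.List using (List; []; _∷_; _++_; map; length; replicate; upTo)
open import Data.List.Relation.Unary.All using (All)
open import Data.List.Membership.Propositional using (_∈_)
open import Data.Product using (Σ; _×_; _,_; ∃; proj₁; proj₂)
open import Data.Sum using (_⊎_)
open import Relation.Binary.PropositionalEquality using (_≡_; _≢_)
open import Relation.Nullary using (¬_)

-- Words, counts, Dyck words (1 = true = up, 0 = false = down)

ones : List Bool → ℕ
ones [] = 0
ones (true ∷ w) = suc (ones w)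
ones (false ∷ w) = ones w

zeros : List Bool → ℕ
zeros [] = 0
zeros (true ∷ w) = zeros w
zeros (false ∷ w) = suc (zeros w)

data Dyck : List Bool → Set where
  ε    : Dyck []
  wrap : ∀ {u v} → Dyck u → Dyck v → Dyck (true ∷ u ++ false ∷ v)

D′ : List Bool → Set
D′ y = Σ (List Bool) λ u → Dyck u × (y ≡ true ∷ u ++ false ∷ [])

comp : List Bool → List Bool
comp = map not

-- (maximal) height of a lattice path starting at height 0
heightGo : ℕ → ℕ → List Bool → ℕ
heightGo h m [] = m
heightGo h m (true ∷ w) = heightGo (suc h) (m ⊔ suc h) w
heightGo h m (false ∷ w) = heightGo (h ∸ 1) m w

height : List Bool → ℕ
height = heightGo 0 0

-- The decomposition  y = 1u_1 1u_2 ⋯ 1u_{h-2} 1 1 v_0 0 v_1 0 ⋯ 0 v_{h-2} 0 0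
-- us = [u_1 … u_{h-2}],  v0 = v_0,  vs = [v_1 … v_{h-2}]

_+ℕ_ : ℤ → ℕ → ℤ
p +ℕ n = p ℤ.+ (+ n)

upW : List (List Bool) → List Bool
upW [] = []
upW (u ∷ us) = true ∷ u ++ upW us

downW : List Bool → List (List Bool) → List Bool
downW v0 [] = v0
downW v0 (v1 ∷ vs) = v0 ++ false ∷ downW v1 vs

decWord : List (List Bool) → List Bool → List (List Bool) → List Bool
decWord us v0 vs = upW us ++ true ∷ true ∷ downW v0 vs ++ false ∷ false ∷ []

-- positions of the marker 1s of the up part (word placed at position p)
upA : ℤ → List (List Bool) → List ℤ
upA p [] = []
upA p (u ∷ us) = p ∷ upA (p +ℕ suc (length u)) us

-- positions of the separating 0s of the down part (v0 placed at position r)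
downB : ℤ → List Bool → List (List Bool) → List ℤ
downB r v0 [] = []
downB r v0 (v1 ∷ vs) = (r +ℕ length v0) ∷ downB (r +ℕ suc (length v0)) v1 vs

downStart : ℤ → List (List Bool) → ℤ
downStart p us = p +ℕ (length (upW us) ℕ.+ 2)

decA : ℤ → List (List Bool) → List ℤ
decA p us = upA p us ++ q ∷ (q +ℕ 1) ∷ []
  where q = p +ℕ length (upW us)

decB : ℤ → List (List Bool) → List Bool → List (List Bool) → List ℤ
decB p us v0 vs = downB (downStart p us) v0 vs ++ e ∷ (e +ℕ 1) ∷ []
  where e = downStart p us +ℕ length (downW v0 vs)

Decomp : List (List Bool) → List Bool → List (List Bool) → Set
Decomp us v0 vs =
  All Dyck us × Dyck (comp v0) × All (λ v → Dyck (comp v)) vs ×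
  (length us ≡ length vs) ×
  (height (decWord us v0 vs) ≡ 2 ℕ.+ length us) ×
  D′ (decWord us v0 vs)

-- Gliders: (A , B) with A, B sets of positions (as lists of integers)

Glider : Set
Glider = List ℤ × List ℤ

-- GD p w g : g ∈ Γ(w) for a Dyck word w placed at positions p, p+1, …
-- GP p y g : g ∈ Γ(y) for y ∈ D' placed at positions p, p+1, …
data GD : ℤ → List Bool → Glider → Set
data GP : ℤ → List Bool → Glider → Set
data InUp : ℤ → List (List Bool) → Glider → Set
data InDown : ℤ → List Bool → List (List Bool) → Glider → Set

data GD where
  -- Γ of a Dyck word is the union of Γ of its factors in D'
  factor : ∀ {p a y b g} → Dyck a → D′ y → Dyck b →
           GP (p +ℕ length a) y g → GD p (a ++ y ++ b) g

data GP where
  base : ∀ {p} → GP p (true ∷ false ∷ []) (p ∷ [] , (p +ℕ 1) ∷ [])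
  self : ∀ {p us v0 vs} → Decomp us v0 vs →
         GP p (decWord us v0 vs) (decA p us , decB p us v0 vs)
  inU  : ∀ {p us v0 vs g} → Decomp us v0 vs → InUp p us g →
         GP p (decWord us v0 vs) g
  inV  : ∀ {p us v0 vs g} → Decomp us v0 vs → InDown (downStart p us) v0 vs g →
         GP p (decWord us v0 vs) g

-- g ∈ Γ(u_i) for some u_i (u_i placed right after its marker 1)
data InUp where
  here  : ∀ {p u us g} → GD (p +ℕ 1) u g → InUp p (u ∷ us) g
  there : ∀ {p u us g} → InUp (p +ℕ suc (length u)) us g → InUp p (u ∷ us) g

data InDown where
  here  : ∀ {r v0 vs g} → GD r (comp v0) g → InDown r v0 vs g
  there : ∀ {r v0 v1 vs g} → InDown (r +ℕ suc (length v0)) v1 vs g →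
          InDown r v0 (v1 ∷ vs) g

hat : ∀ {n} → Vec Bool n → ℤ → Bool
hat {zero} x i = false
hat {suc m} x i = lookup x ((i %ℕ suc m) mod suc m)

window : ∀ {n} → Vec Bool n → ℤ → ℕ → List Bool
window x s L = map (λ j → hat x (s +ℕ j)) (upTo L)

-- the 1 at position a is matched to the 0 at position a + d:
-- [a, a+d] is the shortest substring starting at a with equally many 0s and 1s
Matched : ∀ {n} → Vec Bool n → ℤ → ℕ → Set
Matched x a d =
  (hat x a ≡ true) ×
  (ones (window x a (suc d)) ≡ zeros (window x a (suc d))) ×
  (∀ d′ → d′ < d → ones (window x a (suc d′)) ≢ zeros (window x a (suc d′)))

-- the lattice path of x̂ has height 0 at the boundary point just before
-- position i (height = number of matched pairs (a, b) with a < i ≤ b)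
HeightZero : ∀ {n} → Vec Bool n → ℤ → Set
HeightZero x i = ¬ (Σ ℤ λ a → Σ ℕ λ d → Matched x a d × (a ℤ.< i) × (i ℤ.≤ a +ℕ d))

-- g ∈ Γ(x): g ∈ Γ(y) for a subword y ∈ D' of x̂ (occupying positions
-- s, …, s+L-1) starting and ending at height 0
InΓ : ∀ {n} → Vec Bool n → Glider → Set
InΓ x g = Σ ℤ λ s → Σ ℕ λ L →
  HeightZero x s × HeightZero x (s +ℕ L) × D′ (window x s L) × GP s (window x s L) g

speed : Glider → ℕ
speed g = length (proj₁ g)

Clean : ∀ {n} → Vec Bool n → Glider → Set
Clean x (A , B) = Σ ℤ λ m → Σ ℤ λ M → Σ ℕ λ L →
  (m ∈ A) × All (m ℤ.≤_) A × (M ∈ B) × All (ℤ._≤ M) B ×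
  (m +ℕ L ≡ M ℤ.+ ℤ.1ℤ) ×
  ((window x m L ≡ replicate (length A) true ++ replicate (length A) false) ⊎
   (window x m L ≡ replicate (length A) false ++ replicate (length A) true))

{-# OPTIONS --safe #-}
module Submission where

-- A glider nested in y = 1u0 ∈ D′ of height h lies in some uᵢ, which has room at most
-- h - 1 above it, or in the complement of some vᵢ, which reaches at most h - 1 below
-- its start because u is a Dyck word; and every glider is at most as fast as the room
-- above its word. A nonempty Dyck word always carries a glider, so if the glider built
-- from y itself (speed h) has minimum speed, all uᵢ and vᵢ are empty and y = 1ʰ0ʰ.
-- Gliders nested deeper are clean by induction, complementing inside the vᵢ.

open import Defs
open import Data.Bool using (Bool; true; false; not)
open import Data.Bool.Properties using (not-involutive)
open import Data.Nat using (ℕ; zero; suc; _+_; _*_; _∸_; _⊔_; _≤_; _<_; z≤n; s≤s)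
import Data.Nat.Properties as ℕₚ
open import Data.Nat.Solver using (module +-*-Solver)
open import Data.Integer as ℤ using (ℤ; +_)
import Data.Integer.Properties as ℤₚ
open import Data.Vec using (Vec; toList)
open import Data.List using (List; []; _∷_; [_]; _++_; _∷ʳ_; map; length; replicate; upTo; applyUpTo; initLast; _∷ʳ′_)
import Data.List.Properties as Listₚ
open import Data.List.Relation.Unary.All as All using (All; []; _∷_)
import Data.List.Relation.Unary.All.Properties as Allₚ
open import Data.List.Relation.Unary.Any using (here; there)
import Data.List.Relation.Unary.Any.Properties as Anyₚ
open import Data.List.Membership.Propositional using (_∈_)
open import Data.Product using (Σ; _×_; _,_; proj₁; proj₂)
open import Data.Sum using (_⊎_; inj₁; inj₂)
open import Data.Empty using (⊥-elim)
open import Data.Unit using (⊤; tt)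
open import Function using (_∘_)
open import Algebra.Solver.Monoid (Listₚ.++-monoid Bool) using (solve; _⊜_; _⊕_) renaming (id to nil)
open import Relation.Binary.PropositionalEquality using (_≡_; _≢_; refl; sym; trans; cong; subst; cong₂; module ≡-Reasoning)
open ≡-Reasoning

-- Band a b w c d: the lattice path w, started with room a above it and room b
-- below it, never leaves that strip and ends with room c above and d below.
data Band : ℕ → ℕ → List Bool → ℕ → ℕ → Set where
  []   : ∀ {a b} → Band a b [] a b
  up   : ∀ {a b w c d} → Band a (suc b) w c d → Band (suc a) b (true ∷ w) c d
  down : ∀ {a b w c d} → Band (suc a) b w c d → Band a (suc b) (false ∷ w) c d

Band-++ : ∀ {a b p c d q e f} → Band a b p c d → Band c d q e f → Band a b (p ++ q) e f
Band-++ []       r = r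
Band-++ (up r)   s = up (Band-++ r s)
Band-++ (down r) s = down (Band-++ r s)

Band-++⁻ : ∀ {a b e f} p {q} → Band a b (p ++ q) e f →
           Σ ℕ λ c → Σ ℕ λ d → Band a b p c d × Band c d q e f
Band-++⁻ []          r        = _ , _ , [] , r
Band-++⁻ (true ∷ p)  (up r)   with Band-++⁻ p r
... | c , d , rp , rq = c , d , up rp , rq
Band-++⁻ (false ∷ p) (down r) with Band-++⁻ p r
... | c , d , rp , rq = c , d , down rp , rq

Band-dropPrefix : ∀ {a b p q c d e f} → Band a b (p ++ q) e f → Band a b p c d → Band c d q e f
Band-dropPrefix r        []       = r
Band-dropPrefix (up r)   (up s)   = Band-dropPrefix r s
Band-dropPrefix (down r) (down s) = Band-dropPrefix r s

Band-comp : ∀ {a b w c d} → Band a b w c d → Band b a (comp w) d c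
Band-comp []       = []
Band-comp (up r)   = down (Band-comp r)
Band-comp (down r) = up (Band-comp r)

Band-width : ∀ {a b w c d} → Band a b w c d → c + d ≡ a + b
Band-width []                 = refl
Band-width {suc a} {b} (up r) = trans (Band-width r) (ℕₚ.+-suc a b)
Band-width {a} {suc b} (down r) = trans (Band-width r) (sym (ℕₚ.+-suc a b))

Band-raiseCeiling : ∀ {a b w c d} → Band a b w c d → Band (suc a) b w (suc c) d
Band-raiseCeiling []       = []
Band-raiseCeiling (up r)   = up (Band-raiseCeiling r)
Band-raiseCeiling (down r) = down (Band-raiseCeiling r)

Dyck-++ : ∀ {u v} → Dyck u → Dyck v → Dyck (u ++ v)
Dyck-++ ε dv = dv
Dyck-++ {v = v} (wrap {u₁} {u₂} du₁ du₂) dv =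
  subst Dyck (cong (true ∷_) (sym (Listₚ.++-assoc u₁ (false ∷ u₂) v))) (wrap du₁ (Dyck-++ du₂ dv))

Band-Dyck-returns : ∀ {w a b c d} → Dyck w → Band a b w c d → c ≡ a × d ≡ b
Band-Dyck-returns ε [] = refl , refl
Band-Dyck-returns (wrap {u} du dv) (up r) with Band-++⁻ u r
... | _ , _ , ru , rv with Band-Dyck-returns du ru
... | refl , refl with rv
... | down rv′ = Band-Dyck-returns dv rv′

Band-Dyck-anyFloor : ∀ {w a b c d} → Dyck w → (b′ : ℕ) → Band a b w c d → Band a b′ w a b′
Band-Dyck-anyFloor ε b′ [] = []
Band-Dyck-anyFloor (wrap {u} du dv) b′ (up r) with Band-++⁻ u r
... | _ , _ , ru , rv with Band-Dyck-returns du ru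
... | refl , refl with rv
... | down rv′ = up (Band-++ (Band-Dyck-anyFloor du (suc b′) ru) (down (Band-Dyck-anyFloor dv b′ rv′)))

Band-Dyck-noRoom : ∀ {w b c d} → Dyck w → Band 0 b w c d → w ≡ []
Band-Dyck-noRoom ε _ = refl

level : ℕ → List Bool → ℕ
level l []          = l
level l (true ∷ w)  = level (suc l) w
level l (false ∷ w) = level (l ∸ 1) w

level-Dyck : ∀ {w} → Dyck w → ∀ l → level l w ≡ l
level-Dyck ε l = refl
level-Dyck (wrap {u} {v} du dv) l = begin
  level l (true ∷ u ++ false ∷ v)  ≡⟨ level-++ (suc l) u (false ∷ v) ⟩
  level (level (suc l) u ∸ 1) v    ≡⟨ cong (λ k → level (k ∸ 1) v) (level-Dyck du (suc l)) ⟩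
  level l v                        ≡⟨ level-Dyck dv l ⟩
  l                                ∎
  where
  level-++ : ∀ l xs ys → level l (xs ++ ys) ≡ level (level l xs) ys
  level-++ l []          ys = refl
  level-++ l (true ∷ xs)  ys = level-++ (suc l) xs ys
  level-++ l (false ∷ xs) ys = level-++ (l ∸ 1) xs ys

heightGo-++ : ∀ l m xs ys → heightGo l m (xs ++ ys) ≡ heightGo (level l xs) (heightGo l m xs) ys
heightGo-++ l m []           ys = refl
heightGo-++ l m (true ∷ xs)  ys = heightGo-++ (suc l) (m ⊔ suc l) xs ys
heightGo-++ l m (false ∷ xs) ys = heightGo-++ (l ∸ 1) m xs ys

heightGo-≥ : ∀ l m w → m ≤ heightGo l m w
heightGo-≥ l m []          = ℕₚ.≤-refl
heightGo-≥ l m (true ∷ w)  = ℕₚ.≤-trans (ℕₚ.m≤m⊔n m (suc l)) (heightGo-≥ (suc l) (m ⊔ suc l) w)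
heightGo-≥ l m (false ∷ w) = heightGo-≥ (l ∸ 1) m w

heightGo-prefix : ∀ l m xs ys → heightGo l m xs ≤ heightGo l m (xs ++ ys)
heightGo-prefix l m xs ys rewrite heightGo-++ l m xs ys = heightGo-≥ _ _ ys

-- The band keeps the path at levels ≥ 0, where the truncated subtraction in heightGo is exact.
heightGo-suc : ∀ {a l w c d} → Band a l w c d → ∀ m → heightGo (suc l) (suc m) w ≡ suc (heightGo l m w)
heightGo-suc []       m = refl
heightGo-suc {l = l} (up r) m = heightGo-suc r (m ⊔ suc l)
heightGo-suc (down r) m = heightGo-suc r m

height-true∷ : ∀ w → Σ ℕ λ α → height (true ∷ w) ≡ suc α
height-true∷ w with heightGo 1 1 w | heightGo-≥ 1 1 w
... | suc α | _ = α , refl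

Dyck-Band-fromHeight : ∀ {w} → Dyck w → ∀ a b m → heightGo b m w ≤ a + b → Band a b w a b
Dyck-Band-fromHeight ε a b m h = []
Dyck-Band-fromHeight (wrap {u} {v} du dv) zero b m h =
  ⊥-elim (ℕₚ.<-irrefl refl
    (ℕₚ.≤-trans (ℕₚ.m≤n⊔m m (suc b)) (ℕₚ.≤-trans (heightGo-≥ (suc b) _ (u ++ false ∷ v)) h)))
Dyck-Band-fromHeight (wrap {u} {v} du dv) (suc a) b m h = up (Band-++ ru (down rv))
  where
  M = m ⊔ suc b
  hv : heightGo b (heightGo (suc b) M u) v ≡ heightGo (suc b) M (u ++ false ∷ v)
  hv = sym (trans (heightGo-++ (suc b) M u (false ∷ v))
                  (cong (λ l → heightGo (l ∸ 1) (heightGo (suc b) M u) v) (level-Dyck du (suc b))))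
  ru : Band a (suc b) u a (suc b)
  ru = Dyck-Band-fromHeight du a (suc b) M
         (ℕₚ.≤-trans (heightGo-prefix (suc b) M u (false ∷ v))
                     (ℕₚ.≤-trans h (ℕₚ.≤-reflexive (sym (ℕₚ.+-suc a b)))))
  rv : Band (suc a) b v (suc a) b
  rv = Dyck-Band-fromHeight dv (suc a) b _ (subst (_≤ suc a + b) (sym hv) h)

-- p is the path up to its first step above level α + β (levels counted from the floor).
firstPassage : ∀ {a′ c d} w α β m → Band a′ β w c d → β ≤ m → m ≤ α + β → α + β < heightGo β m w →
               Σ (List Bool) λ p → Σ (List Bool) λ q → w ≡ p ++ true ∷ q × Band α β p 0 (α + β)
firstPassage [] α β m r β≤m m≤t t<h = ⊥-elim (ℕₚ.<-irrefl refl (ℕₚ.≤-trans t<h m≤t))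
firstPassage (true ∷ w) zero β m r β≤m m≤t t<h = [] , w , refl , []
firstPassage (true ∷ w) (suc α) β m (up r) β≤m m≤t t<h
  with firstPassage w α (suc β) (m ⊔ suc β) r (ℕₚ.m≤n⊔m m (suc β))
         (ℕₚ.⊔-lub (ℕₚ.≤-trans m≤t (ℕₚ.≤-reflexive (sym (ℕₚ.+-suc α β)))) (ℕₚ.m≤n+m (suc β) α))
         (subst (_< heightGo (suc β) (m ⊔ suc β) w) (sym (ℕₚ.+-suc α β)) t<h)
... | p , q , refl , rp = true ∷ p , q , refl , subst (Band (suc α) β (true ∷ p) 0) (ℕₚ.+-suc α β) (up rp)
firstPassage (false ∷ w) α (suc β) m (down r) β≤m m≤t t<h
  with firstPassage w (suc α) β m r (ℕₚ.≤-trans (ℕₚ.n≤1+n β) β≤m)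
         (ℕₚ.≤-trans m≤t (ℕₚ.≤-reflexive (ℕₚ.+-suc α β)))
         (subst (_< heightGo β m w) (ℕₚ.+-suc α β) t<h)
... | p , q , refl , rp = false ∷ p , q , refl , subst (Band α (suc β) (false ∷ p) 0) (sym (ℕₚ.+-suc α β)) (down rp)

upW-++ : ∀ xs ys → upW (xs ++ ys) ≡ upW xs ++ upW ys
upW-++ []       ys = refl
upW-++ (u ∷ xs) ys = cong (true ∷_) (trans (cong (u ++_) (upW-++ xs ys)) (sym (Listₚ.++-assoc u (upW xs) (upW ys))))

upW-∷ʳ : ∀ ws w → upW (ws ∷ʳ w) ≡ upW ws ++ true ∷ w
upW-∷ʳ ws w = trans (upW-++ ws [ w ]) (cong (λ z → upW ws ++ true ∷ z) (Listₚ.++-identityʳ w))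

length-∷ʳ : ∀ {A : Set} (xs : List A) x → length (xs ∷ʳ x) ≡ suc (length xs)
length-∷ʳ xs x = trans (Listₚ.length-++ xs) (ℕₚ.+-comm (length xs) 1)

-- w = e 1 w₁ 1 w₂ ⋯ 1 w_l with all e, wᵢ Dyck: the 1s are the last departures from levels 0, …, l - 1.
record LastPassage (w : List Bool) (l : ℕ) : Set where
  constructor lastPassage
  field
    {start}      : List Bool
    {steps}      : List (List Bool)
    start-Dyck   : Dyck start
    steps-Dyck   : All Dyck steps
    steps-length : length steps ≡ l
    split        : w ≡ start ++ upW steps

LastPassage-∷ʳ-true : ∀ {w l} → LastPassage w l → LastPassage (w ∷ʳ true) (suc l)
LastPassage-∷ʳ-true {w} (lastPassage {e} {ws} de dws refl refl) =
  lastPassage de (Allₚ.++⁺ dws (ε ∷ [])) (length-∷ʳ ws []) (begin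
    (e ++ upW ws) ++ [ true ]  ≡⟨ Listₚ.++-assoc e (upW ws) [ true ] ⟩
    e ++ upW ws ++ [ true ]    ≡⟨ cong (e ++_) (sym (upW-∷ʳ ws [])) ⟩
    e ++ upW (ws ∷ʳ [])        ∎)

LastPassage-∷ʳ-false : ∀ {w l} → LastPassage w (suc l) → LastPassage (w ∷ʳ false) l
LastPassage-∷ʳ-false (lastPassage {e} {ws} de dws len refl) with initLast ws
... | [] with len
...   | ()
LastPassage-∷ʳ-false (lastPassage {e} de dws len refl) | ws′ ∷ʳ′ w with Allₚ.++⁻ ws′ dws
... | dws′ , dw ∷ [] with initLast ws′
...   | [] = lastPassage (Dyck-++ de (wrap dw ε)) [] (ℕₚ.suc-injective len)
          (solve 4 (λ e w t f → (e ⊕ t ⊕ w ⊕ nil) ⊕ f ⊜ (e ⊕ t ⊕ w ⊕ f) ⊕ nil) refl e w [ true ] [ false ])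
...   | ws″ ∷ʳ′ w′ with Allₚ.++⁻ ws″ dws′
...     | dws″ , dw′ ∷ [] =
          lastPassage de (Allₚ.++⁺ dws″ (Dyck-++ dw′ (wrap dw ε) ∷ [])) length-steps (begin
            (e ++ upW ((ws″ ∷ʳ w′) ∷ʳ w)) ++ [ false ]
              ≡⟨ cong (λ z → (e ++ z) ++ [ false ])
                      (trans (upW-∷ʳ (ws″ ∷ʳ w′) w) (cong (_++ true ∷ w) (upW-∷ʳ ws″ w′))) ⟩
            (e ++ (upW ws″ ++ true ∷ w′) ++ true ∷ w) ++ [ false ]
              ≡⟨ solve 6 (λ e U w′ w t f → (e ⊕ (U ⊕ t ⊕ w′) ⊕ t ⊕ w) ⊕ f
                                           ⊜ e ⊕ U ⊕ t ⊕ w′ ⊕ t ⊕ w ⊕ f)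
                   refl e (upW ws″) w′ w [ true ] [ false ] ⟩
            e ++ upW ws″ ++ true ∷ w′ ++ true ∷ w ++ [ false ]
              ≡⟨ cong (e ++_) (sym (upW-∷ʳ ws″ _)) ⟩
            e ++ upW (ws″ ∷ʳ (w′ ++ true ∷ w ++ [ false ])) ∎)
          where
          length-steps : length (ws″ ∷ʳ (w′ ++ true ∷ w ++ [ false ])) ≡ _
          length-steps = trans (length-∷ʳ ws″ _) (ℕₚ.suc-injective
            (trans (sym (trans (length-∷ʳ (ws″ ∷ʳ w′) w) (cong suc (length-∷ʳ ws″ w′)))) len))

LastPassage-++ : ∀ {w l a p c d} → LastPassage w l → Band a l p c d → LastPassage (w ++ p) d
LastPassage-++ {w} lp [] = subst (λ z → LastPassage z _) (sym (Listₚ.++-identityʳ w)) lp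
LastPassage-++ {w} {p = true ∷ p} lp (up r) =
  subst (λ z → LastPassage z _) (Listₚ.++-assoc w [ true ] p) (LastPassage-++ (LastPassage-∷ʳ-true lp) r)
LastPassage-++ {w} {p = false ∷ p} lp (down r) =
  subst (λ z → LastPassage z _) (Listₚ.++-assoc w [ false ] p) (LastPassage-++ (LastPassage-∷ʳ-false lp) r)

++-upW-∷ʳ : ∀ e ws w → e ++ upW (ws ∷ʳ w) ≡ (e ++ upW ws) ++ true ∷ w
++-upW-∷ʳ e ws w = trans (cong (e ++_) (upW-∷ʳ ws w)) (sym (Listₚ.++-assoc e (upW ws) (true ∷ w)))

-- A path from the bottom to the top of its band: the last step w_l of its
-- last-passage decomposition is empty, as it is a Dyck word with no room above it.
topPassage : ∀ {α p} → Band α 0 p 0 α →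
             Σ (List (List Bool)) λ us → All Dyck us × length us ≡ α × true ∷ p ≡ upW us ++ [ true ]
topPassage {zero} [] = [] , [] , refl , refl
topPassage {suc α} {p} r with LastPassage-++ (lastPassage ε [] refl refl) r
... | lastPassage {e} {ws} de dws len refl with initLast ws
...   | [] with len
...     | ()
topPassage {suc α} {p} r | lastPassage {e} de dws len refl | ws′ ∷ʳ′ w
  with Allₚ.++⁻ ws′ dws
     | Band-++⁻ (e ++ upW ws′) (subst (λ z → Band (suc α) 0 z 0 (suc α)) (++-upW-∷ʳ e ws′ w) r)
... | dws′ , dw ∷ [] | _ , _ , _ , up rw with Band-Dyck-returns dw rw
...   | refl , _ with Band-Dyck-noRoom dw rw
...     | refl = e ∷ ws′ , de ∷ dws′ , trans (sym (length-∷ʳ ws′ [])) len ,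
                 cong (true ∷_) (++-upW-∷ʳ e ws′ [])

comp-involutive : ∀ w → comp (comp w) ≡ w
comp-involutive []      = refl
comp-involutive (x ∷ w) = cong₂ _∷_ (not-involutive x) (comp-involutive w)

comp-upW : ∀ v ws → v ++ comp (upW ws) ≡ downW v (map comp ws)
comp-upW v []       = Listₚ.++-identityʳ v
comp-upW v (w ∷ ws) = cong (λ z → v ++ false ∷ z) (trans (Listₚ.map-++ not w (upW ws)) (comp-upW (comp w) ws))

Dyck-comp-comp : ∀ {w} → Dyck w → Dyck (comp (comp w))
Dyck-comp-comp {w} = subst Dyck (sym (comp-involutive w))

-- The complement of a path from the top to the bottom of its band climbs to the top.
downPart : ∀ {α S} → Band 0 (suc α) S (suc α) 0 →
           Σ (List Bool) λ v0 → Σ (List (List Bool)) λ vs →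
           Dyck (comp v0) × All (Dyck ∘ comp) vs × length vs ≡ α × S ≡ downW v0 vs ++ [ false ]
downPart r with topPassage (Band-comp r)
... | [] , _ , () , _
downPart {S = S} r | e ∷ ws , de ∷ dws , len , eq =
  comp e , map comp ws , Dyck-comp-comp de , Allₚ.map⁺ (All.map Dyck-comp-comp dws) ,
  trans (Listₚ.length-map comp ws) (ℕₚ.suc-injective len) , (begin
    S                                             ≡⟨ sym (comp-involutive S) ⟩
    comp (comp S)                                 ≡⟨ cong comp (Listₚ.∷-injectiveʳ eq) ⟩
    comp ((e ++ upW ws) ++ [ true ])              ≡⟨ Listₚ.map-++ not (e ++ upW ws) [ true ] ⟩
    comp (e ++ upW ws) ++ [ false ]               ≡⟨ cong (_++ [ false ]) (Listₚ.map-++ not e (upW ws)) ⟩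
    (comp e ++ comp (upW ws)) ++ [ false ]        ≡⟨ cong (_++ [ false ]) (comp-upW (comp e) ws) ⟩
    downW (comp e) (map comp ws) ++ [ false ]     ∎)

Dyck-Band-height : ∀ {u} → Dyck u → ∀ {a} → height u ≡ a → Band a 0 u a 0
Dyck-Band-height du {a} h = Dyck-Band-fromHeight du a 0 0 (ℕₚ.≤-reflexive (trans h (sym (ℕₚ.+-identityʳ a))))

height-D′ : ∀ {u} → Dyck u → height (true ∷ u ++ [ false ]) ≡ suc (height u)
height-D′ {u} du = begin
  heightGo 1 1 (u ++ [ false ])               ≡⟨ heightGo-++ 1 1 u [ false ] ⟩
  heightGo 1 1 u                              ≡⟨ heightGo-suc (Dyck-Band-height du refl) 0 ⟩
  suc (height u)                              ∎

decompose : ∀ {u α} → Dyck u → height u ≡ suc α →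
            Σ (List (List Bool)) λ us → Σ (List Bool) λ v0 → Σ (List (List Bool)) λ vs →
            Decomp us v0 vs × decWord us v0 vs ≡ true ∷ u ++ [ false ]
decompose {u} {α} du h
  with firstPassage u α 0 0 (Dyck-Band-height du h) z≤n z≤n
         (subst (α + 0 <_) (sym h) (s≤s (ℕₚ.≤-reflexive (ℕₚ.+-identityʳ α))))
... | q0 , S , refl , rq
  with topPassage (subst (Band α 0 q0 0) (ℕₚ.+-identityʳ α) rq)
     | Band-dropPrefix (Dyck-Band-height du h) (Band-raiseCeiling (subst (Band α 0 q0 0) (ℕₚ.+-identityʳ α) rq))
... | us , dus , lus , eus | up rS with downPart rS
... | v0 , vs , dv0 , dvs , lvs , refl =
  us , v0 , vs , (dus , dv0 , dvs , trans lus (sym lvs) , height-eq , (_ , du , eq)) , eq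
  where
  eq : decWord us v0 vs ≡ true ∷ (q0 ++ true ∷ downW v0 vs ++ [ false ]) ++ [ false ]
  eq = sym (begin
    true ∷ (q0 ++ true ∷ downW v0 vs ++ [ false ]) ++ [ false ]
      ≡⟨ solve 4 (λ t q D f → t ⊕ ((q ⊕ t ⊕ D ⊕ f) ⊕ f) ⊜ (t ⊕ q) ⊕ t ⊕ D ⊕ f ⊕ f)
                 refl [ true ] q0 (downW v0 vs) [ false ] ⟩
    (true ∷ q0) ++ true ∷ downW v0 vs ++ false ∷ [ false ]
      ≡⟨ cong (_++ true ∷ downW v0 vs ++ false ∷ [ false ]) eus ⟩
    (upW us ++ [ true ]) ++ true ∷ downW v0 vs ++ false ∷ [ false ]
      ≡⟨ Listₚ.++-assoc (upW us) [ true ] _ ⟩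
    decWord us v0 vs ∎)
  height-eq : height (decWord us v0 vs) ≡ 2 + length us
  height-eq = trans (cong height eq) (trans (height-D′ du) (cong suc (trans h (cong suc (sym lus)))))

glider-D′ : ∀ {u} p → Dyck u → Σ Glider (GP p (true ∷ u ++ [ false ]))
glider-D′ p ε = _ , base
glider-D′ p du@(wrap {u} {v} _ _) with height-true∷ (u ++ false ∷ v)
... | α , h with decompose du h
... | us , v0 , vs , dec , eq = _ , subst (λ y → GP p y (decA p us , decB p us v0 vs)) eq (self dec)

glider-Dyck : ∀ {w} p → Dyck w → w ≢ [] → Σ Glider (GD p w)
glider-Dyck p ε w≢[] = ⊥-elim (w≢[] refl)
glider-Dyck p (wrap {u} {v} du dv) _ with glider-D′ (p +ℕ 0) du
... | g , gp = g , subst (λ w → GD p w g) (cong (true ∷_) (Listₚ.++-assoc u [ false ] v))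
                         (factor ε (u , du , refl) dv gp)

empty⊎gliderUp : ∀ {us} p → All Dyck us → All (_≡ []) us ⊎ Σ Glider (InUp p us)
empty⊎gliderUp p [] = inj₁ []
empty⊎gliderUp {(_ ∷ _) ∷ _} p (du ∷ _) with glider-Dyck (p +ℕ 1) du (λ ())
... | g , gd = inj₂ (g , here gd)
empty⊎gliderUp {[] ∷ _} p (_ ∷ dus) with empty⊎gliderUp _ dus
... | inj₁ eus     = inj₁ (refl ∷ eus)
... | inj₂ (g , i) = inj₂ (g , there i)

empty⊎gliderDown : ∀ {v0 vs} r → Dyck (comp v0) → All (Dyck ∘ comp) vs →
                   (v0 ≡ [] × All (_≡ []) vs) ⊎ Σ Glider (InDown r v0 vs)
empty⊎gliderDown {_ ∷ _} r dv0 _ with glider-Dyck r dv0 (λ ())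
... | g , gd = inj₂ (g , here gd)
empty⊎gliderDown {[]} {[]} r _ [] = inj₁ (refl , [])
empty⊎gliderDown {[]} {_ ∷ _} r _ (dv1 ∷ dvs) with empty⊎gliderDown _ dv1 dvs
... | inj₁ (refl , evs) = inj₁ (refl , refl ∷ evs)
... | inj₂ (g , i)      = inj₂ (g , there i)

-- The speed of a glider is bounded by the room above its word

Band-upW-++ : ∀ {us a b z c d} → All Dyck us → Band a b (upW us ++ z) c d →
              Σ ℕ λ a′ → a ≡ length us + a′ × Σ ℕ λ b′ → Band a′ b′ z c d
Band-upW-++ [] r = _ , refl , _ , r
Band-upW-++ {u ∷ us} {z = z} (du ∷ dus) (up r)
  with Band-++⁻ u (subst (λ w → Band _ _ w _ _) (Listₚ.++-assoc u (upW us) z) r)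
... | _ , _ , ru , rest with Band-Dyck-returns du ru
... | refl , refl with Band-upW-++ dus rest
... | a′ , refl , b′ , rz = a′ , refl , b′ , rz

decWord-room : ∀ {us v0 vs a b c d} → Decomp us v0 vs → Band a b (decWord us v0 vs) c d → length us + 2 ≤ a
decWord-room {us} (dus , _) r with Band-upW-++ dus r
... | _ , refl , _ , up (up _) = ℕₚ.+-monoʳ-≤ (length us) (s≤s (s≤s z≤n))

decWord-inner : ∀ us v0 vs {u} → decWord us v0 vs ≡ true ∷ u ++ [ false ] →
                Σ (List Bool) λ t → u ≡ t ++ true ∷ downW v0 vs ++ [ false ]
decWord-inner us v0 vs {u} eq = t , Listₚ.++-cancelʳ [ false ] u _ (Listₚ.∷-injectiveʳ (begin
  true ∷ u ++ [ false ]                                      ≡⟨ sym eq ⟩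
  upW us ++ true ∷ true ∷ downW v0 vs ++ false ∷ [ false ]   ≡⟨ ++-true us _ ⟩
  true ∷ t ++ true ∷ downW v0 vs ++ false ∷ [ false ]
    ≡⟨ solve 4 (λ o t D f → o ⊕ t ⊕ o ⊕ D ⊕ f ⊕ f ⊜ o ⊕ (t ⊕ o ⊕ D ⊕ f) ⊕ f)
               refl [ true ] t (downW v0 vs) [ false ] ⟩
  true ∷ (t ++ true ∷ downW v0 vs ++ [ false ]) ++ [ false ] ∎))
  where
  tail : List (List Bool) → List Bool
  tail []       = []
  tail (u ∷ us) = u ++ upW us ++ [ true ]
  t = tail us
  ++-true : ∀ us z → upW us ++ true ∷ z ≡ true ∷ tail us ++ z
  ++-true []       z = refl
  ++-true (u ∷ us) z =
    solve 4 (λ o u U z → (o ⊕ u ⊕ U) ⊕ o ⊕ z ⊜ o ⊕ (u ⊕ U ⊕ o) ⊕ z) refl [ true ] u (upW us) z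

-- Inside the Dyck word u of y = 1 u 0 the down part starts above u's floor,
-- and u has one unit less of room above than y.
downW-Band : ∀ {us v0 vs a b c d} → Decomp us v0 vs → Band a b (decWord us v0 vs) c d →
             Σ ℕ λ α → Σ ℕ λ β → Σ ℕ λ c′ → Σ ℕ λ d′ →
             Band α β (downW v0 vs ++ [ false ]) c′ d′ × β < a
downW-Band {us} {v0} {vs} (_ , _ , _ , _ , _ , (u , du , eq)) r
  with decWord-inner us v0 vs eq | subst (λ w → Band _ _ w _ _) eq r
... | t , refl | up r′ with Band-++⁻ (t ++ true ∷ downW v0 vs ++ [ false ]) r′
... | _ , _ , ru , _ with Band-++⁻ t (Band-Dyck-anyFloor du 0 ru)
... | _ , β , _ , up rD =
  _ , suc β , _ , _ , rD ,
  s≤s (ℕₚ.≤-trans (ℕₚ.m≤n+m (suc β) _) (ℕₚ.≤-reflexive (trans (sym (Band-width rD)) (ℕₚ.+-identityʳ _))))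

speed-self : ∀ p us v0 vs → speed (decA p us , decB p us v0 vs) ≡ length us + 2
speed-self p us v0 vs = trans (Listₚ.length-++ (upA p us)) (cong (_+ 2) (length-upA p us))
  where
  length-upA : ∀ p us → length (upA p us) ≡ length us
  length-upA p []       = refl
  length-upA p (u ∷ us) = cong suc (length-upA _ us)

downW-prefix : ∀ v0 vs → Σ (List Bool) λ t → downW v0 vs ≡ v0 ++ t
downW-prefix v0 []        = [] , sym (Listₚ.++-identityʳ v0)
downW-prefix v0 (v1 ∷ vs) = _ , refl

mutual
  GD-speed≤ : ∀ {p w g a b c d} → GD p w g → Band a b w c d → speed g ≤ a
  GD-speed≤ (factor {a = e} {y = y} de _ _ gp) r with Band-++⁻ e r
  ... | _ , _ , re , rest with Band-Dyck-returns de re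
  ... | refl , refl with Band-++⁻ y rest
  ... | _ , _ , ry , _ = GP-speed≤ gp ry

  GP-speed≤ : ∀ {p y g a b c d} → GP p y g → Band a b y c d → speed g ≤ a
  GP-speed≤ base (up _) = s≤s z≤n
  GP-speed≤ (self {p = p} {us} {v0} {vs} dec) r =
    subst (_≤ _) (sym (speed-self p us v0 vs)) (decWord-room dec r)
  GP-speed≤ (inU dec iu) r = ℕₚ.<⇒≤ (InUp-speed< (proj₁ dec) iu r)
  GP-speed≤ (inV dec@(_ , dv0 , dvs , _) iv) r with downW-Band dec r
  ... | _ , _ , _ , _ , rD , β<a = ℕₚ.≤-trans (InDown-speed≤ dv0 dvs iv rD) (ℕₚ.<⇒≤ β<a)

  InUp-speed< : ∀ {p us g a b z c d} → All Dyck us → InUp p us g → Band a b (upW us ++ z) c d → speed g < a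
  InUp-speed< {us = u ∷ us} {z = z} (du ∷ dus) iu (up r)
    with Band-++⁻ u (subst (λ w → Band _ _ w _ _) (Listₚ.++-assoc u (upW us) z) r)
  InUp-speed< (du ∷ dus) (here gd) (up r) | _ , _ , ru , _ = s≤s (GD-speed≤ gd ru)
  InUp-speed< (du ∷ dus) (there iu) (up r) | _ , _ , ru , rest with Band-Dyck-returns du ru
  ... | refl , refl = ℕₚ.m<n⇒m<1+n (InUp-speed< dus iu rest)

  InDown-speed≤ : ∀ {r v0 vs g a b z c d} → Dyck (comp v0) → All (Dyck ∘ comp) vs → InDown r v0 vs g →
                  Band a b (downW v0 vs ++ z) c d → speed g ≤ b
  InDown-speed≤ {v0 = v0} {vs} {z = z} _ _ (here gd) rd with downW-prefix v0 vs
  ... | t , eq with Band-++⁻ v0 (subst (λ w → Band _ _ w _ _) (trans (cong (_++ z) eq) (Listₚ.++-assoc v0 t z)) rd)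
  ... | _ , _ , rv0 , _ = GD-speed≤ gd (Band-comp rv0)
  InDown-speed≤ {v0 = v0} {v1 ∷ vs} {z = z} dv0 (dv1 ∷ dvs) (there iv) rd
    with Band-++⁻ v0 (subst (λ w → Band _ _ w _ _) (Listₚ.++-assoc v0 (false ∷ downW v1 vs) z) rd)
  ... | _ , _ , rv0 , rest with Band-Dyck-returns dv0 (Band-comp rv0)
  ... | refl , refl with rest
  ... | down rest′ = ℕₚ.m≤n⇒m≤1+n (InDown-speed≤ dv1 dvs iv rest′)

+ℕ-assoc : ∀ p m n → (p +ℕ m) +ℕ n ≡ p +ℕ (m + n)
+ℕ-assoc p m n = trans (ℤₚ.+-assoc p (+ m) (+ n)) (cong (λ k → p ℤ.+ k) (sym (ℤₚ.pos-+ m n)))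

Occurs : (ℤ → Bool) → ℤ → List Bool → Set
Occurs f p []      = ⊤
Occurs f p (x ∷ y) = f p ≡ x × Occurs f (p +ℕ 1) y

Occurs-at : ∀ {f p q} y → p ≡ q → Occurs f p y → Occurs f q y
Occurs-at y refl o = o

Occurs-++ : ∀ {f p} xs ys → Occurs f p (xs ++ ys) → Occurs f p xs × Occurs f (p +ℕ length xs) ys
Occurs-++ {p = p} []       ys o       = tt , Occurs-at ys (sym (ℤₚ.+-identityʳ p)) o
Occurs-++ {p = p} (x ∷ xs) ys (e , o) with Occurs-++ xs ys o
... | oxs , oys = (e , oxs) , Occurs-at ys (+ℕ-assoc p 1 (length xs)) oys

Occurs-comp : ∀ {f p} y → Occurs f p y → Occurs (not ∘ f) p (comp y)
Occurs-comp []      _       = tt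
Occurs-comp (x ∷ y) (e , o) = cong not e , Occurs-comp y o

readAt : (ℤ → Bool) → ℤ → ℕ → List Bool
readAt f s L = map (λ j → f (s +ℕ j)) (upTo L)

readAt-suc : ∀ f s L → readAt f s (suc L) ≡ f (s +ℕ 0) ∷ readAt f (s +ℕ 1) L
readAt-suc f s L = cong (f (s +ℕ 0) ∷_) (begin
  map (λ j → f (s +ℕ j)) (applyUpTo suc L)          ≡⟨ cong (map _) (sym (Listₚ.map-upTo suc L)) ⟩
  map (λ j → f (s +ℕ j)) (map suc (upTo L))          ≡⟨ sym (Listₚ.map-∘ (upTo L)) ⟩
  map (λ j → f (s +ℕ suc j)) (upTo L)
    ≡⟨ Listₚ.map-cong (λ j → cong f (sym (+ℕ-assoc s 1 j))) (upTo L) ⟩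
  readAt f (s +ℕ 1) L                                ∎)

Occurs-readAt : ∀ f s L → Occurs f s (readAt f s L)
Occurs-readAt f s zero    = tt
Occurs-readAt f s (suc L) =
  subst (Occurs f s) (sym (readAt-suc f s L)) (cong f (sym (ℤₚ.+-identityʳ s)) , Occurs-readAt f (s +ℕ 1) L)

readAt-Occurs : ∀ {f s} y → Occurs f s y → readAt f s (length y) ≡ y
readAt-Occurs             []      _       = refl
readAt-Occurs {f} {s} (x ∷ y) (e , o) =
  trans (readAt-suc f s (length y)) (cong₂ _∷_ (trans (cong f (ℤₚ.+-identityʳ s)) e) (readAt-Occurs y o))

-- Clean x γ is CleanAt (hat x) γ; allowing any string lets complemented words reuse the argument.
CleanAt : (ℤ → Bool) → Glider → Set
CleanAt f (A , B) = Σ ℤ λ m → Σ ℤ λ M → Σ ℕ λ L →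
  (m ∈ A) × All (m ℤ.≤_) A × (M ∈ B) × All (ℤ._≤ M) B ×
  (m +ℕ L ≡ M ℤ.+ ℤ.1ℤ) ×
  ((readAt f m L ≡ replicate (length A) true ++ replicate (length A) false) ⊎
   (readAt f m L ≡ replicate (length A) false ++ replicate (length A) true))

comp-replicate-++ : ∀ v x y → comp (replicate v x ++ replicate v y) ≡ replicate v (not x) ++ replicate v (not y)
comp-replicate-++ v x y =
  trans (Listₚ.map-++ not (replicate v x) (replicate v y))
        (cong₂ _++_ (Listₚ.map-replicate not v x) (Listₚ.map-replicate not v y))

CleanAt-not : ∀ {f} γ → CleanAt (not ∘ f) γ → CleanAt f γ
CleanAt-not {f} (A , B) (m , M , L , m∈A , m≤A , M∈B , B≤M , end , word) =
  m , M , L , m∈A , m≤A , M∈B , B≤M , end , flip word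
  where
  v = length A
  readAt-not : readAt f m L ≡ comp (readAt (not ∘ f) m L)
  readAt-not = trans (sym (comp-involutive _)) (cong comp (sym (Listₚ.map-∘ (upTo L))))
  flip : _ → _
  flip (inj₁ w) = inj₂ (trans readAt-not (trans (cong comp w) (comp-replicate-++ v true false)))
  flip (inj₂ w) = inj₁ (trans readAt-not (trans (cong comp w) (comp-replicate-++ v false true)))

p≤p+ℕ : ∀ p n → p ℤ.≤ p +ℕ n
p≤p+ℕ p n = ℤₚ.i≤i+j p (+ n)

base-clean : ∀ {f p} → Occurs f p (true ∷ false ∷ []) → CleanAt f (p ∷ [] , (p +ℕ 1) ∷ [])
base-clean {f} {p} o =
  p , p +ℕ 1 , 2 , here refl , ℤₚ.≤-refl ∷ [] , here refl , ℤₚ.≤-refl ∷ [] ,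
  sym (+ℕ-assoc p 1 1) , inj₁ (readAt-Occurs {f} {p} _ o)

decA-first : ∀ p us → p ∈ decA p us
decA-first p []       = here (sym (ℤₚ.+-identityʳ p))
decA-first p (u ∷ us) = here refl

decA-lower : ∀ p us → All (p ℤ.≤_) (decA p us)
decA-lower p us = Allₚ.++⁺ (upA-lower p us ℤₚ.≤-refl)
  (p≤p+ℕ p _ ∷ ℤₚ.≤-trans (p≤p+ℕ p _) (p≤p+ℕ _ 1) ∷ [])
  where
  upA-lower : ∀ q us → p ℤ.≤ q → All (p ℤ.≤_) (upA q us)
  upA-lower q []       _   = []
  upA-lower q (u ∷ us) p≤q = p≤q ∷ upA-lower _ us (ℤₚ.≤-trans p≤q (p≤p+ℕ q _))

lastB : ℤ → List (List Bool) → List Bool → List (List Bool) → ℤ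
lastB p us v0 vs = (downStart p us +ℕ length (downW v0 vs)) +ℕ 1

decB-last : ∀ p us v0 vs → lastB p us v0 vs ∈ decB p us v0 vs
decB-last p us v0 vs = Anyₚ.++⁺ʳ (downB (downStart p us) v0 vs) (there (here refl))

decB-upper : ∀ p us v0 vs → All (ℤ._≤ lastB p us v0 vs) (decB p us v0 vs)
decB-upper p us v0 vs = Allₚ.++⁺
  (All.map (λ le → ℤₚ.≤-trans le (p≤p+ℕ _ 1)) (downB-upper (downStart p us) v0 vs))
  (p≤p+ℕ _ 1 ∷ ℤₚ.≤-refl ∷ [])
  where
  downB-upper : ∀ r v0 vs → All (ℤ._≤ r +ℕ length (downW v0 vs)) (downB r v0 vs)
  downB-upper r v0 []        = []
  downB-upper r v0 (v1 ∷ vs) =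
    ℤₚ.+-monoʳ-≤ r (ℤ.+≤+ (Listₚ.length-++-≤ˡ v0)) ∷
    All.map (λ le → ℤₚ.≤-trans le (ℤₚ.≤-reflexive shift)) (downB-upper _ v1 vs)
    where
    shift : (r +ℕ suc (length v0)) +ℕ length (downW v1 vs) ≡ r +ℕ length (downW v0 (v1 ∷ vs))
    shift = trans (+ℕ-assoc r _ _)
      (cong (r +ℕ_) (trans (sym (ℕₚ.+-suc (length v0) _)) (sym (Listₚ.length-++ v0))))

decWord-end : ∀ p us v0 vs → p +ℕ length (decWord us v0 vs) ≡ lastB p us v0 vs ℤ.+ ℤ.1ℤ
decWord-end p us v0 vs = begin
  p +ℕ length (decWord us v0 vs)    ≡⟨ cong (p +ℕ_) length-decWord ⟩
  p +ℕ (U + 2 + D + 1 + 1)          ≡⟨ sym (+ℕ-assoc p _ 1) ⟩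
  (p +ℕ (U + 2 + D + 1)) +ℕ 1       ≡⟨ cong (_+ℕ 1) (sym (+ℕ-assoc p _ 1)) ⟩
  ((p +ℕ (U + 2 + D)) +ℕ 1) +ℕ 1    ≡⟨ cong (λ q → (q +ℕ 1) +ℕ 1) (sym (+ℕ-assoc p (U + 2) D)) ⟩
  lastB p us v0 vs +ℕ 1             ∎
  where
  U = length (upW us)
  D = length (downW v0 vs)
  length-decWord : length (decWord us v0 vs) ≡ U + 2 + D + 1 + 1
  length-decWord = begin
    length (decWord us v0 vs)                           ≡⟨ Listₚ.length-++ (upW us) ⟩
    U + (2 + length (downW v0 vs ++ false ∷ [ false ])) ≡⟨ cong (λ n → U + (2 + n)) (Listₚ.length-++ (downW v0 vs)) ⟩
    U + (2 + (D + 2))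
      ≡⟨ +-*-Solver.solve 2 (λ U D → U :+ (con 2 :+ (D :+ con 2)) := U :+ con 2 :+ D :+ con 1 :+ con 1) refl U D ⟩
    U + 2 + D + 1 + 1                                   ∎
    where open +-*-Solver using (_:+_; _:=_; con)

replicate-++ : ∀ {A : Set} m n (x : A) → replicate m x ++ replicate n x ≡ replicate (m + n) x
replicate-++ zero    n x = refl
replicate-++ (suc m) n x = cong (x ∷_) (replicate-++ m n x)

decWord-trivial : ∀ us vs → All (_≡ []) us → All (_≡ []) vs → length us ≡ length vs →
                  decWord us [] vs ≡ replicate (length us + 2) true ++ replicate (length us + 2) false
decWord-trivial us vs eus evs len = begin
  decWord us [] vs
    ≡⟨ cong₂ (λ T F → T ++ true ∷ true ∷ F ++ false ∷ false ∷ [])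
             (upW-empty us eus) (trans (downW-empty vs evs) (cong (λ n → replicate n false) (sym len))) ⟩
  T ++ replicate 2 true ++ F ++ replicate 2 false
    ≡⟨ solve 4 (λ T t F f → T ⊕ t ⊕ F ⊕ f ⊜ (T ⊕ t) ⊕ (F ⊕ f))
               refl T (replicate 2 true) F (replicate 2 false) ⟩
  (T ++ replicate 2 true) ++ (F ++ replicate 2 false)
    ≡⟨ cong₂ _++_ (replicate-++ k 2 true) (replicate-++ k 2 false) ⟩
  replicate (k + 2) true ++ replicate (k + 2) false ∎
  where
  k = length us
  T = replicate k true
  F = replicate k false
  upW-empty : ∀ us → All (_≡ []) us → upW us ≡ replicate (length us) true
  upW-empty []       []          = refl
  upW-empty (_ ∷ us) (refl ∷ es) = cong (true ∷_) (upW-empty us es)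
  downW-empty : ∀ vs → All (_≡ []) vs → downW [] vs ≡ replicate (length vs) false
  downW-empty []       []          = refl
  downW-empty (_ ∷ vs) (refl ∷ es) = cong (false ∷_) (downW-empty vs es)

trivial-clean : ∀ {f p us vs} → All (_≡ []) us → All (_≡ []) vs → length us ≡ length vs →
                Occurs f p (decWord us [] vs) → CleanAt f (decA p us , decB p us [] vs)
trivial-clean {f} {p} {us} {vs} eus evs len o =
  p , lastB p us [] vs , length (decWord us [] vs) ,
  decA-first p us , decA-lower p us , decB-last p us [] vs , decB-upper p us [] vs ,
  decWord-end p us [] vs ,
  inj₁ (begin
    readAt f p (length (decWord us [] vs))  ≡⟨ readAt-Occurs _ o ⟩
    decWord us [] vs                        ≡⟨ decWord-trivial us vs eus evs len ⟩
    replicate (length us + 2) true ++ replicate (length us + 2) false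
      ≡⟨ cong (λ h → replicate h true ++ replicate h false) (sym (speed-self p us [] vs)) ⟩
    replicate (length (decA p us)) true ++ replicate (length (decA p us)) false ∎)

MinSpeedIn : (Glider → Set) → Glider → Set
MinSpeedIn P γ = ∀ γ′ → P γ′ → speed γ ≤ speed γ′

decWord-Band : ∀ {us v0 vs} → Decomp us v0 vs → Band (length us + 2) 0 (decWord us v0 vs) (length us + 2) 0
decWord-Band {us} (_ , _ , _ , _ , h , (u , du , eq)) =
  Dyck-Band-height (subst Dyck (sym eq) (wrap du ε)) (trans h (ℕₚ.+-comm 2 (length us)))

-- A nonempty uᵢ or vᵢ carries a glider slower than the self glider, whose speed is the height.
self-slowest⇒trivial : ∀ {p us v0 vs} → Decomp us v0 vs →
                       (∀ g → GP p (decWord us v0 vs) g → length us + 2 ≤ speed g) →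
                       All (_≡ []) us × v0 ≡ [] × All (_≡ []) vs
self-slowest⇒trivial {p} {us} dec@(dus , dv0 , dvs , _) slowest with empty⊎gliderUp p dus
... | inj₂ (g , iu) = ⊥-elim (ℕₚ.<⇒≱ (InUp-speed< dus iu (decWord-Band dec)) (slowest g (inU dec iu)))
... | inj₁ eus with empty⊎gliderDown (downStart p us) dv0 dvs
...   | inj₁ (e0 , evs) = eus , e0 , evs
...   | inj₂ (g , iv) with downW-Band dec (decWord-Band dec)
...     | _ , _ , _ , _ , rD , β<h =
          ⊥-elim (ℕₚ.<⇒≱ (ℕₚ.≤-<-trans (InDown-speed≤ dv0 dvs iv rD) β<h) (slowest g (inV dec iv)))

Occurs-downW : ∀ {f p} us v0 vs → Occurs f p (decWord us v0 vs) → Occurs f (downStart p us) (downW v0 vs)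
Occurs-downW {f} {p} us v0 vs o with Occurs-++ (upW us) _ o
... | _ , (_ , _ , o′) = proj₁ (Occurs-++ (downW v0 vs) _ (Occurs-at _ start o′))
  where
  start : ((p +ℕ length (upW us)) +ℕ 1) +ℕ 1 ≡ downStart p us
  start = trans (cong (_+ℕ 1) (+ℕ-assoc p _ 1))
                (trans (+ℕ-assoc p _ 1) (cong (p +ℕ_) (ℕₚ.+-assoc (length (upW us)) 1 1)))

mutual
  GD-clean : ∀ {f p w γ} → GD p w γ → Occurs f p w → MinSpeedIn (GD p w) γ → CleanAt f γ
  GD-clean (factor {a = e} {y} {b} de dy db gp) o min =
    GP-clean gp (proj₁ (Occurs-++ y b (proj₂ (Occurs-++ e (y ++ b) o))))
      (λ g gp′ → min g (factor de dy db gp′))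

  GP-clean : ∀ {f p y γ} → GP p y γ → Occurs f p y → MinSpeedIn (GP p y) γ → CleanAt f γ
  GP-clean base o min = base-clean o
  GP-clean (self {p = p} {us} {v0} {vs} dec@(_ , _ , _ , len , _)) o min
    with self-slowest⇒trivial dec (λ g gp → subst (_≤ speed g) (speed-self p us v0 vs) (min g gp))
  ... | eus , refl , evs = trivial-clean eus evs len o
  GP-clean (inU {us = us} dec iu) o min =
    InUp-clean iu (proj₁ (Occurs-++ (upW us) _ o)) (λ g iu′ → min g (inU dec iu′))
  GP-clean (inV {us = us} {v0} {vs} dec iv) o min =
    InDown-clean iv (Occurs-downW us v0 vs o) (λ g iv′ → min g (inV dec iv′))

  InUp-clean : ∀ {f p us γ} → InUp p us γ → Occurs f p (upW us) → MinSpeedIn (InUp p us) γ → CleanAt f γ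
  InUp-clean (here {u = u} {us} gd) (_ , o) min =
    GD-clean gd (proj₁ (Occurs-++ u (upW us) o)) (λ g gd′ → min g (here gd′))
  InUp-clean {p = p} (there {u = u} {us} iu) (_ , o) min =
    InUp-clean iu (Occurs-at (upW us) (+ℕ-assoc p 1 (length u)) (proj₂ (Occurs-++ u (upW us) o)))
      (λ g iu′ → min g (there iu′))

  InDown-clean : ∀ {f r v0 vs γ} → InDown r v0 vs γ → Occurs f r (downW v0 vs) →
                 MinSpeedIn (InDown r v0 vs) γ → CleanAt f γ
  InDown-clean {f} {v0 = v0} {vs} {γ} (here gd) o min with downW-prefix v0 vs
  ... | t , eq =
    CleanAt-not {f} γ (GD-clean gd (Occurs-comp v0 (proj₁ (Occurs-++ v0 t (subst (Occurs _ _) eq o))))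
      (λ g gd′ → min g (here gd′)))
  InDown-clean {r = r} {v0} {v1 ∷ vs} (there iv) o min with Occurs-++ v0 _ o
  ... | _ , (_ , o′) =
    InDown-clean iv
      (Occurs-at (downW v1 vs) (trans (+ℕ-assoc r (length v0) 1) (cong (r +ℕ_) (ℕₚ.+-comm (length v0) 1))) o′)
      (λ g iv′ → min g (there iv′))

-- Only gliders nested in the word of γ are compared with γ.
lemma14 : (k n : ℕ) → 1 ≤ k → 2 * k + 1 ≤ n →
            (x : Vec Bool n) → ones (toList x) ≡ k →
            (γ : Glider) → InΓ x γ →
            (∀ γ′ → InΓ x γ′ → speed γ ≤ speed γ′) →
            Clean x γ
lemma14 k n _ _ x _ γ (s , L , s-ground , e-ground , y∈D′ , gp) min =
  GP-clean gp (Occurs-readAt (hat x) s L) (λ γ′ gp′ → min γ′ (s , L , s-ground , e-ground , y∈D′ , gp′))
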